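{- Let $G$ be a finite simple graph containing eleven distinct vertices $s,t,x,a,b,c,d,e,f,g,h$ such that the edges of $G$ among these eleven vertices are exactly $$xa,\ xb,\ ac,\ bd,\ cd,\ ce,\ df,\ eg,\ eh,\ fg,\ fh,\ sx,\ st,\ ta,$$ and such that every vertex of this set other than $s$ and $t$ has all its neighbours in $G$ inside the set. Let $R(s,t)$ denote the subgraph of $G$ with these eleven vertices and these fourteen edges. Then in every crumby coloring of $G$, if $s$ is red, then $s$ is rich in $R(s,t)$, i.e., there exist distinct vertices $p,q$ of $R(s,t)$, different from $s$, both red, such that $sp$ and $pq$ are edges of $R(s,t)$.
   Context: A red-blue coloring of the vertices of a graph is called crumby if (1) the subgraph induced by the blue vertices has maximum degree at most $1$, (2) every red vertex has at least one red neighbour, and (3) the subgraph induced by the red vertices contains no path on four vertices as a subgraph (not necessarily induced), i.e., there are no four distinct red vertices $v_1,v_2,v_3,v_4$ with $v_1v_2,v_2v_3,v_3v_4$ edges. A red vertex $v$ is called rich in a subgraph $H$ if there is a red path $v-p-q$ (on three distinct vertices) contained in $H$. -}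

module Defs where

open import Data.Nat using (ℕ)
open import Data.Fin using (Fin)
open import Data.Bool using (Bool; true; false)
open import Data.Product using (Σ; ∃; _×_; _,_)
open import Data.Empty using (⊥)
open import Relation.Nullary using (¬_)
open import Relation.Binary.PropositionalEquality using (_≡_; _≢_)
open import Function.Bundles using (_⇔_)

record SimpleGraph (n : ℕ) : Set₁ where
  field
    Adj   : Fin n → Fin n → Set
    sym   : ∀ {u v} → Adj u v → Adj v u
    irrefl : ∀ {v} → ¬ Adj v v
open SimpleGraph public

Red : ∀ {n} → (Fin n → Bool) → Fin n → Set
Red col v = col v ≡ true

Blue : ∀ {n} → (Fin n → Bool) → Fin n → Set
Blue col v = col v ≡ false

record Crumby {n : ℕ} (G : SimpleGraph n) (col : Fin n → Bool) : Set where
  field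
    -- (1) blue subgraph has maximum degree at most 1: no blue vertex has two
    --     distinct blue neighbours
    blueDeg : ∀ v y z → Blue col v → Blue col y → Blue col z →
              Adj G v y → Adj G v z → y ≡ z
    redNbr  : ∀ v → Red col v → ∃ λ w → Red col w × Adj G v w
    noP4    : ∀ v₁ v₂ v₃ v₄ →
              v₁ ≢ v₂ → v₁ ≢ v₃ → v₁ ≢ v₄ → v₂ ≢ v₃ → v₂ ≢ v₄ → v₃ ≢ v₄ →
              Red col v₁ → Red col v₂ → Red col v₃ → Red col v₄ →
              Adj G v₁ v₂ → Adj G v₂ v₃ → Adj G v₃ v₄ → ⊥

data Lab : Set where
  s t x a b c d e f g h : Lab

data REdge₀ : Lab → Lab → Set where
  xa : REdge₀ x a
  xb : REdge₀ x b
  ac : REdge₀ a c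
  bd : REdge₀ b d
  cd : REdge₀ c d
  ce : REdge₀ c e
  df : REdge₀ d f
  eg : REdge₀ e g
  eh : REdge₀ e h
  fg : REdge₀ f g
  fh : REdge₀ f h
  sx : REdge₀ s x
  st : REdge₀ s t
  ta : REdge₀ t a

data REdge (u v : Lab) : Set where
  fwd : REdge₀ u v → REdge u v
  bwd : REdge₀ v u → REdge u v

record Gadget {n : ℕ} (G : SimpleGraph n) (φ : Lab → Fin n) : Set where
  field
    distinct : ∀ u v → φ u ≡ φ v → u ≡ v
    edges    : ∀ u v → Adj G (φ u) (φ v) ⇔ REdge u v
    closed   : ∀ u → u ≢ s → u ≢ t → ∀ w → Adj G (φ u) w → ∃ λ v → w ≡ φ v

{-# OPTIONS --safe #-}
-- First, c and d are never both
-- red: the 4-cycle e g f h forces e or f to be red, and, if only one of them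
-- is, also g or h, so a red edge cd always extends to a red P4. Second, a and b
-- are never both blue: a blue c (or d) would then make d, e (or c, f) red and
-- close a red P4 d f · e (or c e · f) through g or h. Hence if x is red,
-- s–x–a or s–x–b is a red path. If x is blue, b makes d red, so c is blue, so
-- a is red (or it would have the blue neighbours x and c), and a's red
-- neighbour can only be t.
module Submission where

open import Defs
open import Data.Nat using (ℕ; _≟_)
open import Data.Fin using (Fin)
open import Data.Bool using (Bool; true; false)
open import Data.Bool.Properties using (not-¬; ¬-not)
open import Data.Product using (∃; ∃₂; _×_; _,_)
open import Data.Empty using (⊥; ⊥-elim)
open import Function using (_∘_)
open import Function.Bundles using (Equivalence)
open import Relation.Nullary.Decidable using (False; toWitnessFalse)
open import Relation.Binary.PropositionalEquality using (_≡_; _≢_; refl; cong)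

-- s and t may have red neighbours outside R(s,t), so condition (2) is only
-- imposed on the other nine vertices.
record CrumbyOnR (κ : Lab → Bool) : Set where
  field
    blueDeg : ∀ {u v w} → κ u ≡ false → κ v ≡ false → κ w ≡ false →
              REdge u v → REdge u w → v ≡ w
    redNbr  : ∀ {u} → u ≢ s → u ≢ t → κ u ≡ true →
              ∃ λ v → κ v ≡ true × REdge u v
    noP4    : ∀ {v₁ v₂ v₃ v₄} →
              v₁ ≢ v₂ → v₁ ≢ v₃ → v₁ ≢ v₄ → v₂ ≢ v₃ → v₂ ≢ v₄ → v₃ ≢ v₄ →
              κ v₁ ≡ true → κ v₂ ≡ true → κ v₃ ≡ true → κ v₄ ≡ true →
              REdge v₁ v₂ → REdge v₂ v₃ → REdge v₃ v₄ → ⊥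

module _ {n} {G : SimpleGraph n} {φ : Lab → Fin n} (gadget : Gadget G φ) where
  open Gadget gadget
  open Equivalence

  φ-preserves-≢ : ∀ {u v} → u ≢ v → φ u ≢ φ v
  φ-preserves-≢ u≢v = u≢v ∘ distinct _ _

  adjacent : ∀ {u v} → REdge u v → Adj G (φ u) (φ v)
  adjacent {u} {v} = from (edges u v)

  crumby⇒crumbyOnR : ∀ {col} → Crumby G col → CrumbyOnR (col ∘ φ)
  crumby⇒crumbyOnR {col} crumby = record
    { blueDeg = λ u⁻ v⁻ w⁻ uv uw →
        distinct _ _ (Crumby.blueDeg crumby _ _ _ u⁻ v⁻ w⁻ (adjacent uv) (adjacent uw))
    ; redNbr  = redNbr
    ; noP4    = λ n₁₂ n₁₃ n₁₄ n₂₃ n₂₄ n₃₄ r₁ r₂ r₃ r₄ e₁ e₂ e₃ →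
        Crumby.noP4 crumby _ _ _ _
          (φ-preserves-≢ n₁₂) (φ-preserves-≢ n₁₃) (φ-preserves-≢ n₁₄)
          (φ-preserves-≢ n₂₃) (φ-preserves-≢ n₂₄) (φ-preserves-≢ n₃₄)
          r₁ r₂ r₃ r₄ (adjacent e₁) (adjacent e₂) (adjacent e₃)
    }
    where
    redNbr : ∀ {u} → u ≢ s → u ≢ t → col (φ u) ≡ true →
             ∃ λ v → col (φ v) ≡ true × REdge u v
    redNbr {u} u≢s u≢t u⁺ with Crumby.redNbr crumby (φ u) u⁺
    ... | w , w⁺ , uw with closed u u≢s u≢t w uw
    ...   | v , refl = v , w⁺ , to (edges u v) uw

index : Lab → ℕ
index s = 0
index t = 1
index x = 2
index a = 3
index b = 4
index c = 5
index d = 6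
index e = 7
index f = 8
index g = 9
index h = 10

-- On two distinct concrete labels this normalises to ⊤, so implicit arguments of
-- this type are inferred.
Apart : Lab → Lab → Set
Apart u v = False (index u ≟ index v)

apart⇒≢ : ∀ {u v} → Apart u v → u ≢ v
apart⇒≢ u#v = toWitnessFalse u#v ∘ cong index

RichInR : (Lab → Bool) → Lab → Set
RichInR κ v = ∃₂ λ p q → p ≢ v × q ≢ v × p ≢ q ×
  κ p ≡ true × κ q ≡ true × REdge v p × REdge p q

module _ {κ : Lab → Bool} (crumby : CrumbyOnR κ) where
  open CrumbyOnR crumby

  data Colour (v : Lab) : Set where
    red  : κ v ≡ true → Colour v
    blue : κ v ≡ false → Colour v

  colour : ∀ v → Colour v
  colour v with κ v in κv
  ... | true  = red κv
  ... | false = blue κv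

  blue-partner : ∀ {u v w} {v#w : Apart v w} → κ u ≡ false → κ v ≡ false →
                 REdge u v → REdge u w → κ w ≡ true
  blue-partner {v#w = v#w} u⁻ v⁻ uv uw =
    ¬-not λ w⁻ → apart⇒≢ v#w (blueDeg u⁻ v⁻ w⁻ uv uw)

  red-neighbour : ∀ {u} {u#s : Apart u s} {u#t : Apart u t} → κ u ≡ true →
                  ∃ λ v → κ v ≡ true × REdge u v
  red-neighbour {u#s = u#s} {u#t} = redNbr (apart⇒≢ u#s) (apart⇒≢ u#t)

  red-P4 : ∀ {v₁ v₂ v₃ v₄}
           {#₁₂ : Apart v₁ v₂} {#₁₃ : Apart v₁ v₃} {#₁₄ : Apart v₁ v₄}
           {#₂₃ : Apart v₂ v₃} {#₂₄ : Apart v₂ v₄} {#₃₄ : Apart v₃ v₄} →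
           κ v₁ ≡ true → κ v₂ ≡ true → κ v₃ ≡ true → κ v₄ ≡ true →
           REdge v₁ v₂ → REdge v₂ v₃ → REdge v₃ v₄ → ⊥
  red-P4 {#₁₂ = #₁₂} {#₁₃} {#₁₄} {#₂₃} {#₂₄} {#₃₄} =
    noP4 (apart⇒≢ #₁₂) (apart⇒≢ #₁₃) (apart⇒≢ #₁₄)
         (apart⇒≢ #₂₃) (apart⇒≢ #₂₄) (apart⇒≢ #₃₄)

  blue-if-neighbours-blue : ∀ {u} {u#s : Apart u s} {u#t : Apart u t} →
                            (∀ {v} → REdge u v → κ v ≡ false) → κ u ≡ false
  blue-if-neighbours-blue {u} {u#s} {u#t} neighbours-blue = ¬-not λ u⁺ →
    let (_ , v⁺ , uv) = red-neighbour {u} {u#s} {u#t} u⁺ in not-¬ v⁺ (neighbours-blue uv)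

  e-f-not-both-blue : κ e ≡ false → κ f ≡ false → ⊥
  e-f-not-both-blue e⁻ f⁻ = not-¬ (blue-partner e⁻ g⁻ (fwd eg) (fwd eh)) h⁻
    where
    g⁻ : κ g ≡ false
    g⁻ = blue-if-neighbours-blue λ { (bwd eg) → e⁻ ; (bwd fg) → f⁻ }
    h⁻ : κ h ≡ false
    h⁻ = blue-if-neighbours-blue λ { (bwd eh) → e⁻ ; (bwd fh) → f⁻ }

  c-d-not-both-red : κ c ≡ true → κ d ≡ true → ⊥
  c-d-not-both-red c⁺ d⁺ with colour e | colour f
  ... | red e⁺  | red f⁺  = red-P4 e⁺ c⁺ d⁺ f⁺ (bwd ce) (fwd cd) (fwd df)
  ... | blue e⁻ | blue f⁻ = e-f-not-both-blue e⁻ f⁻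
  ... | red e⁺  | blue f⁻ with colour g
  ...   | red g⁺  = red-P4 g⁺ e⁺ c⁺ d⁺ (bwd eg) (bwd ce) (fwd cd)
  ...   | blue g⁻ = red-P4 (blue-partner f⁻ g⁻ (fwd fg) (fwd fh)) e⁺ c⁺ d⁺
                           (bwd eh) (bwd ce) (fwd cd)
  c-d-not-both-red c⁺ d⁺ | blue e⁻ | red f⁺ with colour g
  ...   | red g⁺  = red-P4 c⁺ d⁺ f⁺ g⁺ (fwd cd) (fwd df) (fwd fg)
  ...   | blue g⁻ = red-P4 c⁺ d⁺ f⁺ (blue-partner e⁻ g⁻ (fwd eg) (fwd eh))
                           (fwd cd) (fwd df) (fwd fh)

  a-b-blue⇒c-red : κ a ≡ false → κ b ≡ false → κ c ≡ true
  a-b-blue⇒c-red a⁻ b⁻ = ¬-not λ c⁻ →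
    d-e-not-both-red c⁻ (blue-partner c⁻ a⁻ (bwd ac) (fwd cd))
                        (blue-partner c⁻ a⁻ (bwd ac) (fwd ce))
    where
    d-e-not-both-red : κ c ≡ false → κ d ≡ true → κ e ≡ true → ⊥
    d-e-not-both-red c⁻ d⁺ e⁺ with red-neighbour d⁺ | red-neighbour e⁺
    ... | _ , b⁺ , bwd bd | _               = not-¬ b⁺ b⁻
    ... | _ , c⁺ , bwd cd | _               = not-¬ c⁺ c⁻
    ... | _ , _  , fwd df | _ , c⁺ , bwd ce = not-¬ c⁺ c⁻
    ... | _ , f⁺ , fwd df | _ , g⁺ , fwd eg = red-P4 d⁺ f⁺ g⁺ e⁺ (fwd df) (fwd fg) (bwd eg)
    ... | _ , f⁺ , fwd df | _ , h⁺ , fwd eh = red-P4 d⁺ f⁺ h⁺ e⁺ (fwd df) (fwd fh) (bwd eh)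

  a-b-blue⇒d-red : κ a ≡ false → κ b ≡ false → κ d ≡ true
  a-b-blue⇒d-red a⁻ b⁻ = ¬-not λ d⁻ →
    c-f-not-both-red d⁻ (blue-partner d⁻ b⁻ (bwd bd) (bwd cd))
                        (blue-partner d⁻ b⁻ (bwd bd) (fwd df))
    where
    c-f-not-both-red : κ d ≡ false → κ c ≡ true → κ f ≡ true → ⊥
    c-f-not-both-red d⁻ c⁺ f⁺ with red-neighbour c⁺ | red-neighbour f⁺
    ... | _ , a⁺ , bwd ac | _               = not-¬ a⁺ a⁻
    ... | _ , d⁺ , fwd cd | _               = not-¬ d⁺ d⁻
    ... | _ , _  , fwd ce | _ , d⁺ , bwd df = not-¬ d⁺ d⁻
    ... | _ , e⁺ , fwd ce | _ , g⁺ , fwd fg = red-P4 c⁺ e⁺ g⁺ f⁺ (fwd ce) (fwd eg) (bwd fg)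
    ... | _ , e⁺ , fwd ce | _ , h⁺ , fwd fh = red-P4 c⁺ e⁺ h⁺ f⁺ (fwd ce) (fwd eh) (bwd fh)

  a-b-not-both-blue : κ a ≡ false → κ b ≡ false → ⊥
  a-b-not-both-blue a⁻ b⁻ = c-d-not-both-red (a-b-blue⇒c-red a⁻ b⁻) (a-b-blue⇒d-red a⁻ b⁻)

  x-blue⇒d-red : κ x ≡ false → κ d ≡ true
  x-blue⇒d-red x⁻ with colour b
  ... | blue b⁻ = blue-partner b⁻ x⁻ (bwd xb) (fwd bd)
  ... | red b⁺ with red-neighbour b⁺
  ...   | _ , x⁺ , bwd xb = ⊥-elim (not-¬ x⁺ x⁻)
  ...   | _ , d⁺ , fwd bd = d⁺

  x-blue⇒c-blue : κ x ≡ false → κ c ≡ false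
  x-blue⇒c-blue x⁻ = ¬-not λ c⁺ → c-d-not-both-red c⁺ (x-blue⇒d-red x⁻)

  x-blue⇒a-red : κ x ≡ false → κ a ≡ true
  x-blue⇒a-red x⁻ = ¬-not λ a⁻ →
    not-¬ (blue-partner a⁻ x⁻ (bwd xa) (fwd ac)) (x-blue⇒c-blue x⁻)

  s-rich : RichInR κ s
  s-rich with colour x
  ... | red x⁺ with colour a | colour b
  ...   | red a⁺  | _       = x , a , (λ ()) , (λ ()) , (λ ()) , x⁺ , a⁺ , fwd sx , fwd xa
  ...   | blue _  | red b⁺  = x , b , (λ ()) , (λ ()) , (λ ()) , x⁺ , b⁺ , fwd sx , fwd xb
  ...   | blue a⁻ | blue b⁻ = ⊥-elim (a-b-not-both-blue a⁻ b⁻)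
  s-rich | blue x⁻ with red-neighbour (x-blue⇒a-red x⁻)
  ... | _ , t⁺ , bwd ta =
    t , a , (λ ()) , (λ ()) , (λ ()) , t⁺ , x-blue⇒a-red x⁻ , fwd st , fwd ta
  ... | _ , x⁺ , bwd xa = ⊥-elim (not-¬ x⁺ x⁻)
  ... | _ , c⁺ , fwd ac = ⊥-elim (not-¬ c⁺ (x-blue⇒c-blue x⁻))

lemma3 : ∀ (n : ℕ) (G : SimpleGraph n) (φ : Lab → Fin n) →
    Gadget G φ → ∀ (col : Fin n → Bool) → Crumby G col →
    col (φ s) ≡ true →
    ∃₂ λ (p q : Lab) → p ≢ s × q ≢ s × p ≢ q ×
      col (φ p) ≡ true × col (φ q) ≡ true × REdge s p × REdge p q
lemma3 _ _ _ gadget _ crumby _ = s-rich (crumby⇒crumbyOnR gadget crumby)
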